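{- Let $r>k\ge 2$ be integers. There exist real numbers $\alpha_0,\dots,\alpha_k$ (depending only on $r$ and $k$) such that the following holds. Let $J$ be a copy of the complete $k$-uniform hypergraph $K^{(k)}_{k+r}$ and let $e\in E(J)$. Define $\omega$ on the set $\mathcal K^{(k)}_r(J)$ of copies of $K^{(k)}_r$ in $J$ by $\omega(K):=\alpha_{|V(e)\cap V(K)|}$. Then (i) for every edge $f\in E(J)$, $\sum_{K\in\mathcal K^{(k)}_r(J):\, f\in E(K)}\omega(K)=1$ if $f=e$ and $=0$ if $f\ne e$; (ii) for each $0\le i\le k$, $|\alpha_i|\leq \frac{2^{k-i}(k-i)!}{\binom{r-k+i}{i}}$ (so if $|V(e)\cap V(K)|=i$ then $|\omega(K)|=|\alpha_i|$ satisfies this bound).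
   Context: $K^{(k)}_m$ denotes the complete $k$-uniform hypergraph on $m$ vertices; $V(e)$ is the vertex set of an edge $e$. -}

module Defs where

open import Data.Nat using (ℕ; zero; suc; _≟_)
open import Data.List using (List; []; _∷_; _++_; map; filter; foldr)
open import Data.Vec using (_∷_; [])
open import Data.Fin.Subset using (Subset; inside; outside; ∣_∣; _⊆_; _∩_)
open import Data.Fin.Subset.Properties using (_⊆?_)
open import Data.Rational using (ℚ; 0ℚ; _+_)
open import Relation.Nullary.Decidable using (_×-dec_)

allSubsets : (n : ℕ) → List (Subset n)
allSubsets zero = [] ∷ []
allSubsets (suc n) = map (inside ∷_) (allSubsets n) ++ map (outside ∷_) (allSubsets n)

sumℚ : List ℚ → ℚ
sumℚ = foldr _+_ 0ℚ

-- The copies K of K^(k)_r in J = K^(k)_n (vertex set Fin n) with f ∈ E(K):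
-- since J is complete, copies of K^(k)_r correspond exactly to r-subsets V(K)
-- of Fin n, and a k-set f is an edge of K iff f ⊆ V(K).
copiesContaining : (n r : ℕ) → Subset n → List (Subset n)
copiesContaining n r f = filter (λ K → (∣ K ∣ ≟ r) ×-dec (f ⊆? K)) (allSubsets n)

weightSum : (n r : ℕ) (α : ℕ → ℚ) (e f : Subset n) → ℚ
weightSum n r α e f = sumℚ (map (λ K → α ∣ e ∩ K ∣) (copiesContaining n r f))

-- Write α_i = Σ_p C(k-i, p) γ_p, so that α_{|e ∩ K|} = Σ_{T ⊆ e ∖ K} γ_{|T|}. Exchanging the sums
-- over K and T, the weight of an edge f becomes Σ_{T ⊆ e ∖ f} N(T) γ_{|T|}, where N(T) = C(r-|T|, r-k)
-- is the number of r-sets containing f and avoiding T. With γ_p = (-1)^p / C(r-p, r-k) every term is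
-- (-1)^{|T|}, and Σ_{T ⊆ e ∖ f} (-1)^{|T|} is 1 if e ∖ f = ∅, i.e. f = e, and 0 otherwise.
-- For (ii), C(r-p, r-k) ≥ C(r-k+i, i) whenever p ≤ k-i, so |α_i| C(r-k+i, i) ≤ 2^{k-i}.

module Submission where

open import Defs
open import Data.Nat as ℕ using (ℕ; zero; suc; _≤_; _<_; _+_; _∸_; _^_; _!; z≤n; s≤s; _≡ᵇ_)
import Data.Nat.Properties as ℕ
import Data.Nat.Coprimality as Coprime
open import Data.Nat.Combinatorics using (_C_; nCk≡nC[n∸k]; nCk+nC[k+1]≡[n+1]C[k+1])
open import Data.Fin.Subset as S using (Subset; inside; outside; _∩_; _─_; ∁)
open import Data.Fin.Subset.Properties using (_⊆?_; drop-∷-⊆; ∣p∩q∣≤∣q∣; ∣∁p∣≡n∸∣p∣; p⊆q⇒∣p∣≤∣q∣)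
open import Data.Rational as Q using (ℚ; 0ℚ; 1ℚ; 1/_)
import Data.Rational.Properties as Q
open import Data.Product using (Σ; _×_; _,_)
open import Relation.Binary.PropositionalEquality
  using (_≡_; _≢_; refl; sym; trans; cong; cong₂; subst; module ≡-Reasoning)
open import Data.Integer as ℤ using (+_)
import Data.Integer.Properties as ℤ
open import Data.Bool using (Bool; true; false; if_then_else_; _∧_)
import Data.Bool.Properties as Bool
open import Data.List using (List; []; _∷_; _++_; map; filter)
import Data.List.Properties as List
open import Data.Vec using ([]; _∷_; here)
open import Data.Empty using (⊥-elim)
open import Function using (_∘_)
open import Relation.Nullary using (does; yes; no)
open import Relation.Unary using (Pred; Decidable)
open import Algebra.Bundles using (Ring; CommutativeMonoid)
open import Algebra.Properties.CommutativeSemigroup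
  (CommutativeMonoid.commutativeSemigroup Q.+-0-commutativeMonoid) using (interchange)
open import Algebra.Properties.CommutativeSemigroup
  (CommutativeMonoid.commutativeSemigroup Q.*-1-commutativeMonoid) using (x∙yz≈y∙xz)
open import Algebra.Properties.Semiring.Mult (Ring.semiring Q.+-*-ring)
  using (×-homo-+; ×-assoc-*) renaming (_×_ to _·_)

fromℕ : ℕ → ℚ
fromℕ n = + n Q./ 1

fromℕ-suc : ∀ n → fromℕ (suc n) ≡ 1ℚ Q.+ fromℕ n
fromℕ-suc n = begin
  + suc n Q./ 1                      ≡⟨ cong (λ m → (+ 1 ℤ.+ m) Q./ 1) (sym (ℤ.*-identityʳ (+ n))) ⟩
  1ℚ Q.+ Q.mkℚ (+ n) 0 1-coprime    ≡⟨ cong (1ℚ Q.+_) (sym (Q.normalize-coprime 1-coprime)) ⟩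
  1ℚ Q.+ fromℕ n                     ∎
  where
  open ≡-Reasoning
  1-coprime = Coprime.sym (Coprime.1-coprimeTo n)

·1≡fromℕ : ∀ n → n · 1ℚ ≡ fromℕ n
·1≡fromℕ zero    = refl
·1≡fromℕ (suc n) = trans (cong (1ℚ Q.+_) (·1≡fromℕ n)) (sym (fromℕ-suc n))

fromℕ-+ : ∀ m n → fromℕ (m + n) ≡ fromℕ m Q.+ fromℕ n
fromℕ-+ m n = begin
  fromℕ (m + n)              ≡⟨ sym (·1≡fromℕ (m + n)) ⟩
  (m + n) · 1ℚ               ≡⟨ ×-homo-+ 1ℚ m n ⟩
  m · 1ℚ Q.+ n · 1ℚ          ≡⟨ cong₂ Q._+_ (·1≡fromℕ m) (·1≡fromℕ n) ⟩
  fromℕ m Q.+ fromℕ n        ∎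
  where open ≡-Reasoning

·≡fromℕ* : ∀ n x → n · x ≡ fromℕ n Q.* x
·≡fromℕ* n x = begin
  n · x              ≡⟨ cong (n ·_) (sym (Q.*-identityˡ x)) ⟩
  n · (1ℚ Q.* x)     ≡⟨ sym (×-assoc-* n 1ℚ x) ⟩
  (n · 1ℚ) Q.* x     ≡⟨ cong (Q._* x) (·1≡fromℕ n) ⟩
  fromℕ n Q.* x      ∎
  where open ≡-Reasoning

fromℕ-nonNeg : ∀ n → 0ℚ Q.≤ fromℕ n
fromℕ-nonNeg n = Q.nonNegative⁻¹ (fromℕ n) {{Q.normalize-nonNeg n 1}}

fromℕ-mono-≤ : ∀ {m n} → m ≤ n → fromℕ m Q.≤ fromℕ n
fromℕ-mono-≤ {m} {n} m≤n = begin
  fromℕ m                       ≡⟨ sym (Q.+-identityʳ (fromℕ m)) ⟩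
  fromℕ m Q.+ 0ℚ                ≤⟨ Q.+-monoʳ-≤ (fromℕ m) (fromℕ-nonNeg (n ∸ m)) ⟩
  fromℕ m Q.+ fromℕ (n ∸ m)     ≡⟨ sym (fromℕ-+ m (n ∸ m)) ⟩
  fromℕ (m + (n ∸ m))           ≡⟨ cong fromℕ (ℕ.m+[n∸m]≡n m≤n) ⟩
  fromℕ n                       ∎
  where open Q.≤-Reasoning

fromℕ-suc-pos : ∀ n → Q.Positive (fromℕ (suc n))
fromℕ-suc-pos n = Q.normalize-pos (suc n) 1

fromℕ-suc-nonZero : ∀ n → Q.NonZero (fromℕ (suc n))
fromℕ-suc-nonZero n = Q.pos⇒nonZero (fromℕ (suc n)) {{fromℕ-suc-pos n}}

-- recip 0 = 0 is a junk value.
recip : ℕ → ℚ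
recip zero    = 0ℚ
recip (suc n) = (1/ fromℕ (suc n)) {{fromℕ-suc-nonZero n}}

fromℕ*recip : ∀ {n} → 1 ≤ n → fromℕ n Q.* recip n ≡ 1ℚ
fromℕ*recip {suc n} _ = Q.*-inverseʳ (fromℕ (suc n)) {{fromℕ-suc-nonZero n}}

recip-nonNeg : ∀ n → 0ℚ Q.≤ recip n
recip-nonNeg zero    = Q.≤-refl
recip-nonNeg (suc n) = Q.nonNegative⁻¹ (recip (suc n))
  {{Q.pos⇒nonNeg (recip (suc n)) {{Q.1/pos⇒pos (fromℕ (suc n)) {{fromℕ-suc-pos n}}}}}}

recip*fromℕ≤1 : ∀ {m n} → m ≤ n → recip n Q.* fromℕ m Q.≤ 1ℚ
recip*fromℕ≤1 {zero}  {zero}  _   = Q.nonNegative⁻¹ 1ℚ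
recip*fromℕ≤1 {m}     {suc n} m≤n = begin
  recip (suc n) Q.* fromℕ m          ≤⟨ Q.*-monoˡ-≤-nonNeg (recip (suc n)) {{Q.nonNegative (recip-nonNeg (suc n))}}
                                                               (fromℕ-mono-≤ m≤n) ⟩
  recip (suc n) Q.* fromℕ (suc n)    ≡⟨ Q.*-comm (recip (suc n)) (fromℕ (suc n)) ⟩
  fromℕ (suc n) Q.* recip (suc n)    ≡⟨ fromℕ*recip {suc n} (s≤s z≤n) ⟩
  1ℚ                                 ∎
  where open Q.≤-Reasoning

k≤n⇒0<nCk : ∀ {n k} → k ≤ n → 0 < n C k
k≤n⇒0<nCk {n}     {zero}  _         = s≤s z≤n
k≤n⇒0<nCk {suc n} {suc k} (s≤s k≤n) =
  subst (0 <_) (nCk+nC[k+1]≡[n+1]C[k+1] n k) (ℕ.≤-trans (k≤n⇒0<nCk k≤n) (ℕ.m≤m+n _ _))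

nCk≤[1+n]Ck : ∀ n k → n C k ≤ suc n C k
nCk≤[1+n]Ck n zero    = ℕ.≤-refl
nCk≤[1+n]Ck n (suc k) = subst (n C suc k ≤_) (nCk+nC[k+1]≡[n+1]C[k+1] n k) (ℕ.m≤n+m _ _)

C-monoˡ-≤ : ∀ {m n} k → m ≤ n → m C k ≤ n C k
C-monoˡ-≤ {m} k m≤n = go (ℕ.≤⇒≤′ m≤n)
  where
  go : ∀ {n} → m ℕ.≤′ n → m C k ≤ n C k
  go ℕ.≤′-refl         = ℕ.≤-refl
  go (ℕ.≤′-step {n} p) = ℕ.≤-trans (go p) (nCk≤[1+n]Ck n k)

-- choose⊇ a N r is the number of r-subsets of an (a + N)-set containing a fixed a-subset.
choose⊇ : ℕ → ℕ → ℕ → ℕ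
choose⊇ zero    N r       = N C r
choose⊇ (suc a) N zero    = 0
choose⊇ (suc a) N (suc r) = choose⊇ a N r

choose⊇-+ : ∀ a N s → choose⊇ a N (a + s) ≡ N C s
choose⊇-+ zero    N s = refl
choose⊇-+ (suc a) N s = choose⊇-+ a N s

choose⊇-[1+N]0 : ∀ a N → choose⊇ a (suc N) 0 ≡ choose⊇ a N 0
choose⊇-[1+N]0 zero    N = refl
choose⊇-[1+N]0 (suc a) N = refl

choose⊇-pascal : ∀ a N r → choose⊇ a (suc N) (suc r) ≡ choose⊇ a N r + choose⊇ a N (suc r)
choose⊇-pascal zero    N r       = sym (nCk+nC[k+1]≡[n+1]C[k+1] N r)
choose⊇-pascal (suc a) N zero    = choose⊇-[1+N]0 a N
choose⊇-pascal (suc a) N (suc r) = choose⊇-pascal a N r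

∑ : {A : Set} → List A → (A → ℚ) → ℚ
∑ xs F = sumℚ (map F xs)

syntax ∑ xs (λ x → e) = ∑[ x ∈ xs ] e

module _ {A : Set} where

  ∑-cong : (xs : List A) {F G : A → ℚ} → (∀ x → F x ≡ G x) → ∑ xs F ≡ ∑ xs G
  ∑-cong xs F≗G = cong sumℚ (List.map-cong F≗G xs)

  ∑-zero : (xs : List A) {F : A → ℚ} → (∀ x → F x ≡ 0ℚ) → ∑ xs F ≡ 0ℚ
  ∑-zero []       F≗0 = refl
  ∑-zero (x ∷ xs) F≗0 = trans (cong₂ Q._+_ (F≗0 x) (∑-zero xs F≗0)) (Q.+-identityˡ 0ℚ)

  ∑-++ : (xs ys : List A) (F : A → ℚ) → ∑ (xs ++ ys) F ≡ ∑ xs F Q.+ ∑ ys F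
  ∑-++ []       ys F = sym (Q.+-identityˡ (∑ ys F))
  ∑-++ (x ∷ xs) ys F = trans (cong (F x Q.+_) (∑-++ xs ys F)) (sym (Q.+-assoc (F x) _ _))

  ∑-+ : (xs : List A) (F G : A → ℚ) → ∑[ x ∈ xs ] (F x Q.+ G x) ≡ ∑ xs F Q.+ ∑ xs G
  ∑-+ []       F G = refl
  ∑-+ (x ∷ xs) F G = trans (cong (F x Q.+ G x Q.+_) (∑-+ xs F G)) (interchange (F x) (G x) _ _)

  ∑-if : (b : Bool) (xs : List A) (F : A → ℚ) →
         (if b then ∑ xs F else 0ℚ) ≡ ∑[ x ∈ xs ] (if b then F x else 0ℚ)
  ∑-if true  xs F = refl
  ∑-if false xs F = sym (∑-zero xs (λ _ → refl))

  ∑-filter : ∀ {p} {P : Pred A p} (P? : Decidable P) (xs : List A) (F : A → ℚ) →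
             ∑ (filter P? xs) F ≡ ∑[ x ∈ xs ] (if does (P? x) then F x else 0ℚ)
  ∑-filter P? []       F = refl
  ∑-filter P? (x ∷ xs) F with does (P? x)
  ... | true  = cong (F x Q.+_) (∑-filter P? xs F)
  ... | false = trans (∑-filter P? xs F) (sym (Q.+-identityˡ _))

  ∑-map : {B : Set} (g : B → A) (xs : List B) (F : A → ℚ) → ∑ (map g xs) F ≡ ∑ xs (F ∘ g)
  ∑-map g xs F = cong sumℚ (sym (List.map-∘ xs))

∑-swap : {A B : Set} (xs : List A) (ys : List B) (F : A → B → ℚ) →
         ∑[ x ∈ xs ] ∑[ y ∈ ys ] F x y ≡ ∑[ y ∈ ys ] ∑[ x ∈ xs ] F x y
∑-swap []       ys F = sym (∑-zero ys (λ _ → refl))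
∑-swap (x ∷ xs) ys F =
  trans (cong (∑ ys (F x) Q.+_) (∑-swap xs ys F)) (sym (∑-+ ys (F x) (λ y → ∑[ x ∈ xs ] F x y)))

∑-allSubsets-suc : ∀ n (F : Subset (suc n) → ℚ) →
  ∑ (allSubsets (suc n)) F ≡ ∑[ K ∈ allSubsets n ] F (inside ∷ K) Q.+ ∑[ K ∈ allSubsets n ] F (outside ∷ K)
∑-allSubsets-suc n F = trans (∑-++ (map (inside ∷_) (allSubsets n)) _ F)
  (cong₂ Q._+_ (∑-map (inside ∷_) (allSubsets n) F) (∑-map (outside ∷_) (allSubsets n) F))

infix 7 _⊆ᵇ_

_⊆ᵇ_ : ∀ {n} → Subset n → Subset n → Bool
p ⊆ᵇ q = does (p ⊆? q)

⊆ᵇ-─ : ∀ {n} (t p q : Subset n) → t ⊆ᵇ (p ─ q) ≡ t ⊆ᵇ p ∧ q ⊆ᵇ ∁ t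
⊆ᵇ-─ []            []            []            = refl
⊆ᵇ-─ (outside ∷ t) (_ ∷ p)       (inside ∷ q)  = ⊆ᵇ-─ t p q
⊆ᵇ-─ (outside ∷ t) (_ ∷ p)       (outside ∷ q) = ⊆ᵇ-─ t p q
⊆ᵇ-─ (inside ∷ t)  (inside ∷ p)  (inside ∷ q)  = sym (Bool.∧-zeroʳ (t ⊆ᵇ p))
⊆ᵇ-─ (inside ∷ t)  (inside ∷ p)  (outside ∷ q) = ⊆ᵇ-─ t p q
⊆ᵇ-─ (inside ∷ t)  (outside ∷ p) (inside ∷ q)  = refl
⊆ᵇ-─ (inside ∷ t)  (outside ∷ p) (outside ∷ q) = refl

∣p─q∣+∣p∩q∣≡∣p∣ : ∀ {n} (p q : Subset n) → S.∣ p ─ q ∣ + S.∣ p ∩ q ∣ ≡ S.∣ p ∣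
∣p─q∣+∣p∩q∣≡∣p∣ []            []            = refl
∣p─q∣+∣p∩q∣≡∣p∣ (inside ∷ p)  (inside ∷ q)  = trans (ℕ.+-suc _ _) (cong suc (∣p─q∣+∣p∩q∣≡∣p∣ p q))
∣p─q∣+∣p∩q∣≡∣p∣ (inside ∷ p)  (outside ∷ q) = cong suc (∣p─q∣+∣p∩q∣≡∣p∣ p q)
∣p─q∣+∣p∩q∣≡∣p∣ (outside ∷ p) (inside ∷ q)  = ∣p─q∣+∣p∩q∣≡∣p∣ p q
∣p─q∣+∣p∩q∣≡∣p∣ (outside ∷ p) (outside ∷ q) = ∣p─q∣+∣p∩q∣≡∣p∣ p q

q⊆p⇒∣p─q∣+∣q∣≡∣p∣ : ∀ {n} {p q : Subset n} → q S.⊆ p → S.∣ p ─ q ∣ + S.∣ q ∣ ≡ S.∣ p ∣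
q⊆p⇒∣p─q∣+∣q∣≡∣p∣ {p = []}          {[]}          _   = refl
q⊆p⇒∣p─q∣+∣q∣≡∣p∣ {p = inside ∷ p}  {inside ∷ q}  q⊆p = trans (ℕ.+-suc _ _) (cong suc (q⊆p⇒∣p─q∣+∣q∣≡∣p∣ (drop-∷-⊆ q⊆p)))
q⊆p⇒∣p─q∣+∣q∣≡∣p∣ {p = inside ∷ p}  {outside ∷ q} q⊆p = cong suc (q⊆p⇒∣p─q∣+∣q∣≡∣p∣ (drop-∷-⊆ q⊆p))
q⊆p⇒∣p─q∣+∣q∣≡∣p∣ {p = outside ∷ p} {outside ∷ q} q⊆p = q⊆p⇒∣p─q∣+∣q∣≡∣p∣ (drop-∷-⊆ q⊆p)
q⊆p⇒∣p─q∣+∣q∣≡∣p∣ {p = outside ∷ p} {inside ∷ q}  q⊆p with () ← q⊆p here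

∣p─p∣≡0 : ∀ {n} (p : Subset n) → S.∣ p ─ p ∣ ≡ 0
∣p─p∣≡0 []            = refl
∣p─p∣≡0 (inside ∷ p)  = ∣p─p∣≡0 p
∣p─p∣≡0 (outside ∷ p) = ∣p─p∣≡0 p

∣p─q∣≡0⇒p≡q : ∀ {n} (p q : Subset n) → S.∣ p ─ q ∣ ≡ 0 → S.∣ p ∣ ≡ S.∣ q ∣ → p ≡ q
∣p─q∣≡0⇒p≡q []            []            _ _ = refl
∣p─q∣≡0⇒p≡q (inside ∷ p)  (inside ∷ q)  d≡0 p≡q = cong (inside ∷_) (∣p─q∣≡0⇒p≡q p q d≡0 (ℕ.suc-injective p≡q))
∣p─q∣≡0⇒p≡q (outside ∷ p) (outside ∷ q) d≡0 p≡q = cong (outside ∷_) (∣p─q∣≡0⇒p≡q p q d≡0 p≡q)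
∣p─q∣≡0⇒p≡q (outside ∷ p) (inside ∷ q)  d≡0 p≡q = ⊥-elim (ℕ.<-irrefl p≡q (s≤s ∣p∣≤∣q∣))
  where
  ∣p∣≤∣q∣ : S.∣ p ∣ ≤ S.∣ q ∣
  ∣p∣≤∣q∣ = subst (_≤ S.∣ q ∣) (trans (cong (_+ S.∣ p ∩ q ∣) (sym d≡0)) (∣p─q∣+∣p∩q∣≡∣p∣ p q)) (∣p∩q∣≤∣q∣ p q)

-- binomialTransform g q = Σ_{p ≤ q} (q C p) g p, computed by Pascal's rule.
binomialTransform : (ℕ → ℚ) → ℕ → ℚ
binomialTransform g zero    = g 0
binomialTransform g (suc q) = binomialTransform (g ∘ suc) q Q.+ binomialTransform g q

∑⊆≡binomialTransform : ∀ {n} (X : Subset n) (g : ℕ → ℚ) →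
  ∑[ T ∈ allSubsets n ] (if T ⊆ᵇ X then g S.∣ T ∣ else 0ℚ) ≡ binomialTransform g S.∣ X ∣
∑⊆≡binomialTransform         []            g = Q.+-identityʳ (g 0)
∑⊆≡binomialTransform {suc n} (inside ∷ X)  g = trans (∑-allSubsets-suc n _)
  (cong₂ Q._+_ (∑⊆≡binomialTransform X (g ∘ suc)) (∑⊆≡binomialTransform X g))
∑⊆≡binomialTransform {suc n} (outside ∷ X) g = trans (∑-allSubsets-suc n _)
  (trans (cong₂ Q._+_ (∑-zero (allSubsets n) (λ _ → refl)) (∑⊆≡binomialTransform X g))
         (Q.+-identityˡ _))

binomialTransform-neg : ∀ g q → binomialTransform (Q.-_ ∘ g) q ≡ Q.- binomialTransform g q
binomialTransform-neg g zero    = refl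
binomialTransform-neg g (suc q) =
  trans (cong₂ Q._+_ (binomialTransform-neg (g ∘ suc) q) (binomialTransform-neg g q))
        (sym (Q.neg-distrib-+ (binomialTransform (g ∘ suc) q) (binomialTransform g q)))

sign : ℕ → ℚ
sign zero    = 1ℚ
sign (suc p) = Q.- sign p

binomialTransform-sign : ∀ q → binomialTransform sign (suc q) ≡ 0ℚ
binomialTransform-sign q =
  trans (cong (Q._+ binomialTransform sign q) (binomialTransform-neg sign q)) (Q.+-inverseˡ (binomialTransform sign q))

∣binomialTransform∣*x≤2^q : ∀ q (g : ℕ → ℚ) x → 0ℚ Q.≤ x → (∀ p → p ≤ q → Q.∣ g p ∣ Q.* x Q.≤ 1ℚ) →
  Q.∣ binomialTransform g q ∣ Q.* x Q.≤ fromℕ (2 ^ q)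
∣binomialTransform∣*x≤2^q zero    g x 0≤x bound = bound 0 z≤n
∣binomialTransform∣*x≤2^q (suc q) g x 0≤x bound = begin
  Q.∣ A Q.+ B ∣ Q.* x                 ≤⟨ Q.*-monoʳ-≤-nonNeg x {{Q.nonNegative 0≤x}} (Q.∣p+q∣≤∣p∣+∣q∣ A B) ⟩
  (Q.∣ A ∣ Q.+ Q.∣ B ∣) Q.* x         ≡⟨ Q.*-distribʳ-+ x Q.∣ A ∣ Q.∣ B ∣ ⟩
  Q.∣ A ∣ Q.* x Q.+ Q.∣ B ∣ Q.* x     ≤⟨ Q.+-mono-≤ A-bound B-bound ⟩
  fromℕ (2 ^ q) Q.+ fromℕ (2 ^ q)     ≡⟨ sym (fromℕ-+ (2 ^ q) (2 ^ q)) ⟩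
  fromℕ (2 ^ q + 2 ^ q)               ≡⟨ cong (λ m → fromℕ (2 ^ q + m)) (sym (ℕ.+-identityʳ (2 ^ q))) ⟩
  fromℕ (2 ^ suc q)                   ∎
  where
  open Q.≤-Reasoning
  A = binomialTransform (g ∘ suc) q
  B = binomialTransform g q
  A-bound = ∣binomialTransform∣*x≤2^q q (g ∘ suc) x 0≤x (λ p p≤q → bound (suc p) (s≤s p≤q))
  B-bound = ∣binomialTransform∣*x≤2^q q g x 0≤x (λ p p≤q → bound p (ℕ.m≤n⇒m≤1+n p≤q))

if-false : ∀ {b} (x : ℚ) → b ≡ false → (if b then x else 0ℚ) ≡ 0ℚ
if-false x refl = refl

if-+ : ∀ b (x y : ℚ) → (if b then x Q.+ y else 0ℚ) ≡ (if b then x else 0ℚ) Q.+ (if b then y else 0ℚ)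
if-+ true  x y = refl
if-+ false x y = refl

if-0 : ∀ b → (if b then 0ℚ else 0ℚ) ≡ 0ℚ
if-0 true  = refl
if-0 false = refl

if-swap : ∀ a b c (x : ℚ) →
  (if a then (if b ∧ c then x else 0ℚ) else 0ℚ) ≡ (if b then (if a ∧ c then x else 0ℚ) else 0ℚ)
if-swap true  true  c x = refl
if-swap true  false c x = refl
if-swap false true  c x = refl
if-swap false false c x = refl

∑-size-interval : ∀ {n} (f X : Subset n) r (x : ℚ) →
  ∑[ K ∈ allSubsets n ] (if ((S.∣ K ∣ ≡ᵇ r) ∧ f ⊆ᵇ K) ∧ K ⊆ᵇ X then x else 0ℚ)
    ≡ (if f ⊆ᵇ X then choose⊇ S.∣ f ∣ S.∣ X ─ f ∣ r · x else 0ℚ)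
∑-size-interval {zero}  []            []            zero    x = refl
∑-size-interval {zero}  []            []            (suc r) x = refl
∑-size-interval {suc n} (inside ∷ f)  (inside ∷ X)  zero    x =
  trans (∑-allSubsets-suc n _)
    (trans (cong₂ Q._+_ (∑-zero (allSubsets n) (λ _ → refl))
                        (∑-zero (allSubsets n) (λ K → if-false x (cong (_∧ K ⊆ᵇ X) (Bool.∧-zeroʳ _)))))
           (sym (if-0 (f ⊆ᵇ X))))
∑-size-interval {suc n} (inside ∷ f)  (inside ∷ X)  (suc r) x =
  trans (∑-allSubsets-suc n _)
    (trans (cong₂ Q._+_ (∑-size-interval f X r x)
                        (∑-zero (allSubsets n) (λ K → if-false x (cong (_∧ K ⊆ᵇ X) (Bool.∧-zeroʳ _)))))
           (Q.+-identityʳ _))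
∑-size-interval {suc n} (inside ∷ f)  (outside ∷ X) r       x =
  trans (∑-allSubsets-suc n _)
    (cong₂ Q._+_ (∑-zero (allSubsets n) (λ K → if-false x (Bool.∧-zeroʳ _)))
                 (∑-zero (allSubsets n) (λ K → if-false x (cong (_∧ K ⊆ᵇ X) (Bool.∧-zeroʳ _)))))
∑-size-interval {suc n} (outside ∷ f) (inside ∷ X)  zero    x =
  trans (∑-allSubsets-suc n _)
    (trans (cong₂ Q._+_ (∑-zero (allSubsets n) (λ _ → refl)) (∑-size-interval f X 0 x))
    (trans (Q.+-identityˡ _)
           (cong (λ c → if f ⊆ᵇ X then c · x else 0ℚ) (sym (choose⊇-[1+N]0 S.∣ f ∣ S.∣ X ─ f ∣)))))
∑-size-interval {suc n} (outside ∷ f) (inside ∷ X)  (suc r) x =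
  trans (∑-allSubsets-suc n _)
    (trans (cong₂ Q._+_ (∑-size-interval f X r x) (∑-size-interval f X (suc r) x))
    (trans (sym (if-+ (f ⊆ᵇ X) _ _))
           (cong (λ y → if f ⊆ᵇ X then y else 0ℚ) (begin
             choose⊇ a N r · x Q.+ choose⊇ a N (suc r) · x   ≡⟨ sym (×-homo-+ x (choose⊇ a N r) _) ⟩
             (choose⊇ a N r + choose⊇ a N (suc r)) · x       ≡⟨ cong (_· x) (sym (choose⊇-pascal a N r)) ⟩
             choose⊇ a (suc N) (suc r) · x                   ∎))))
  where
  open ≡-Reasoning
  a = S.∣ f ∣
  N = S.∣ X ─ f ∣
∑-size-interval {suc n} (outside ∷ f) (outside ∷ X) r       x =
  trans (∑-allSubsets-suc n _)
    (trans (cong₂ Q._+_ (∑-zero (allSubsets n) (λ K → if-false x (Bool.∧-zeroʳ _))) (∑-size-interval f X r x))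
           (Q.+-identityˡ _))

weightSum-expansion : ∀ {n} r k (g : ℕ → ℚ) (e f : Subset n) → S.∣ e ∣ ≡ k →
  weightSum n r (λ i → binomialTransform g (k ∸ i)) e f ≡
  ∑[ T ∈ allSubsets n ]
    (if T ⊆ᵇ e then (if f ⊆ᵇ ∁ T then choose⊇ S.∣ f ∣ S.∣ ∁ T ─ f ∣ r · g S.∣ T ∣ else 0ℚ) else 0ℚ)
weightSum-expansion {n} r k g e f ∣e∣≡k = begin
  ∑ (copiesContaining n r f) (λ K → w S.∣ e ∩ K ∣)
    ≡⟨ ∑-filter _ subsets (λ K → w S.∣ e ∩ K ∣) ⟩
  ∑[ K ∈ subsets ] (if ok K then w S.∣ e ∩ K ∣ else 0ℚ)
    ≡⟨ ∑-cong subsets (λ K → cong (λ y → if ok K then y else 0ℚ) (w-expansion K)) ⟩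
  ∑[ K ∈ subsets ] (if ok K then ∑[ T ∈ subsets ] (if T ⊆ᵇ (e ─ K) then g S.∣ T ∣ else 0ℚ) else 0ℚ)
    ≡⟨ ∑-cong subsets (λ K → ∑-if (ok K) subsets _) ⟩
  ∑[ K ∈ subsets ] ∑[ T ∈ subsets ] (if ok K then (if T ⊆ᵇ (e ─ K) then g S.∣ T ∣ else 0ℚ) else 0ℚ)
    ≡⟨ ∑-swap subsets subsets _ ⟩
  ∑[ T ∈ subsets ] ∑[ K ∈ subsets ] (if ok K then (if T ⊆ᵇ (e ─ K) then g S.∣ T ∣ else 0ℚ) else 0ℚ)
    ≡⟨ ∑-cong subsets (λ T → ∑-cong subsets (λ K → separate T K)) ⟩
  ∑[ T ∈ subsets ] ∑[ K ∈ subsets ] (if T ⊆ᵇ e then (if ok K ∧ K ⊆ᵇ ∁ T then g S.∣ T ∣ else 0ℚ) else 0ℚ)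
    ≡⟨ ∑-cong subsets (λ T → sym (∑-if (T ⊆ᵇ e) subsets _)) ⟩
  ∑[ T ∈ subsets ] (if T ⊆ᵇ e then ∑[ K ∈ subsets ] (if ok K ∧ K ⊆ᵇ ∁ T then g S.∣ T ∣ else 0ℚ) else 0ℚ)
    ≡⟨ ∑-cong subsets (λ T → cong (λ y → if T ⊆ᵇ e then y else 0ℚ) (∑-size-interval f (∁ T) r (g S.∣ T ∣))) ⟩
  ∑[ T ∈ subsets ]
    (if T ⊆ᵇ e then (if f ⊆ᵇ ∁ T then choose⊇ S.∣ f ∣ S.∣ ∁ T ─ f ∣ r · g S.∣ T ∣ else 0ℚ) else 0ℚ) ∎
  where
  open ≡-Reasoning
  subsets = allSubsets n
  w = λ i → binomialTransform g (k ∸ i)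
  ok = λ (K : Subset n) → (S.∣ K ∣ ≡ᵇ r) ∧ f ⊆ᵇ K

  w-expansion : ∀ K → w S.∣ e ∩ K ∣ ≡ ∑[ T ∈ subsets ] (if T ⊆ᵇ (e ─ K) then g S.∣ T ∣ else 0ℚ)
  w-expansion K = begin
    binomialTransform g (k ∸ S.∣ e ∩ K ∣)
      ≡⟨ cong (λ m → binomialTransform g (m ∸ S.∣ e ∩ K ∣)) (trans (sym ∣e∣≡k) (sym (∣p─q∣+∣p∩q∣≡∣p∣ e K))) ⟩
    binomialTransform g (S.∣ e ─ K ∣ + S.∣ e ∩ K ∣ ∸ S.∣ e ∩ K ∣)
      ≡⟨ cong (binomialTransform g) (ℕ.m+n∸n≡m S.∣ e ─ K ∣ S.∣ e ∩ K ∣) ⟩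
    binomialTransform g S.∣ e ─ K ∣
      ≡⟨ sym (∑⊆≡binomialTransform (e ─ K) g) ⟩
    ∑[ T ∈ subsets ] (if T ⊆ᵇ (e ─ K) then g S.∣ T ∣ else 0ℚ) ∎

  separate : ∀ T K → (if ok K then (if T ⊆ᵇ (e ─ K) then g S.∣ T ∣ else 0ℚ) else 0ℚ)
                   ≡ (if T ⊆ᵇ e then (if ok K ∧ K ⊆ᵇ ∁ T then g S.∣ T ∣ else 0ℚ) else 0ℚ)
  separate T K = trans (cong (λ b → if ok K then (if b then g S.∣ T ∣ else 0ℚ) else 0ℚ) (⊆ᵇ-─ T e K))
                       (if-swap (ok K) (T ⊆ᵇ e) (K ⊆ᵇ ∁ T) (g S.∣ T ∣))

∣sign∣≡1 : ∀ p → Q.∣ sign p ∣ ≡ 1ℚ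
∣sign∣≡1 zero    = refl
∣sign∣≡1 (suc p) = trans (Q.∣-p∣≡∣p∣ (sign p)) (∣sign∣≡1 p)

γ : ℕ → ℕ → ℕ → ℚ
γ r k p = sign p Q.* recip ((r ∸ p) C (r ∸ k))

α : ℕ → ℕ → ℕ → ℚ
α r k i = binomialTransform (γ r k) (k ∸ i)

∣γ∣≡recip : ∀ r k p → Q.∣ γ r k p ∣ ≡ recip ((r ∸ p) C (r ∸ k))
∣γ∣≡recip r k p = begin
  Q.∣ sign p Q.* recip M ∣           ≡⟨ Q.∣p*q∣≡∣p∣*∣q∣ (sign p) (recip M) ⟩
  Q.∣ sign p ∣ Q.* Q.∣ recip M ∣     ≡⟨ cong₂ Q._*_ (∣sign∣≡1 p) (Q.0≤p⇒∣p∣≡p (recip-nonNeg M)) ⟩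
  1ℚ Q.* recip M                     ≡⟨ Q.*-identityˡ (recip M) ⟩
  recip M                            ∎
  where
  open ≡-Reasoning
  M = (r ∸ p) C (r ∸ k)

module _ {r k : ℕ} (k≤r : k ≤ r) {e f : Subset (k + r)} (∣e∣≡k : S.∣ e ∣ ≡ k) (∣f∣≡k : S.∣ f ∣ ≡ k) where

  private
    ∣T∣≤k : ∀ {T} → T S.⊆ e → S.∣ T ∣ ≤ k
    ∣T∣≤k T⊆e = subst (_ ≤_) ∣e∣≡k (p⊆q⇒∣p∣≤∣q∣ T⊆e)

  #copies-avoiding : ∀ {T} → T S.⊆ e → f S.⊆ ∁ T →
    choose⊇ S.∣ f ∣ S.∣ ∁ T ─ f ∣ r ≡ (r ∸ S.∣ T ∣) C (r ∸ k)
  #copies-avoiding {T} T⊆e f⊆∁T = begin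
    choose⊇ S.∣ f ∣ N r            ≡⟨ cong₂ (λ a s → choose⊇ a N s) ∣f∣≡k (sym (ℕ.m+[n∸m]≡n k≤r)) ⟩
    choose⊇ k N (k + (r ∸ k))      ≡⟨ choose⊇-+ k N (r ∸ k) ⟩
    N C (r ∸ k)                    ≡⟨ cong (_C (r ∸ k)) (ℕ.+-cancelʳ-≡ k N (r ∸ t) N+k≡r∸t+k) ⟩
    (r ∸ t) C (r ∸ k)              ∎
    where
    open ≡-Reasoning
    t = S.∣ T ∣
    N = S.∣ ∁ T ─ f ∣
    N+k≡r∸t+k : N + k ≡ (r ∸ t) + k
    N+k≡r∸t+k = begin
      N + k              ≡⟨ cong (λ m → N + m) (sym ∣f∣≡k) ⟩
      N + S.∣ f ∣        ≡⟨ q⊆p⇒∣p─q∣+∣q∣≡∣p∣ f⊆∁T ⟩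
      S.∣ ∁ T ∣          ≡⟨ ∣∁p∣≡n∸∣p∣ T ⟩
      (k + r) ∸ t        ≡⟨ ℕ.+-∸-assoc k (ℕ.≤-trans (∣T∣≤k T⊆e) k≤r) ⟩
      k + (r ∸ t)        ≡⟨ ℕ.+-comm k (r ∸ t) ⟩
      (r ∸ t) + k        ∎

  #copies-avoiding·γ≡sign : ∀ {T} → T S.⊆ e → f S.⊆ ∁ T →
    choose⊇ S.∣ f ∣ S.∣ ∁ T ─ f ∣ r · γ r k S.∣ T ∣ ≡ sign S.∣ T ∣
  #copies-avoiding·γ≡sign {T} T⊆e f⊆∁T = begin
    choose⊇ S.∣ f ∣ S.∣ ∁ T ─ f ∣ r · γ r k t  ≡⟨ cong (_· γ r k t) (#copies-avoiding T⊆e f⊆∁T) ⟩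
    M · (sign t Q.* recip M)                   ≡⟨ ·≡fromℕ* M _ ⟩
    fromℕ M Q.* (sign t Q.* recip M)           ≡⟨ x∙yz≈y∙xz (fromℕ M) (sign t) (recip M) ⟩
    sign t Q.* (fromℕ M Q.* recip M)           ≡⟨ cong (sign t Q.*_) (fromℕ*recip (k≤n⇒0<nCk (ℕ.∸-monoʳ-≤ r (∣T∣≤k T⊆e)))) ⟩
    sign t Q.* 1ℚ                              ≡⟨ Q.*-identityʳ (sign t) ⟩
    sign t                                     ∎
    where
    open ≡-Reasoning
    t = S.∣ T ∣
    M = (r ∸ t) C (r ∸ k)

  weightSum-α : weightSum (k + r) r (α r k) e f ≡ binomialTransform sign S.∣ e ─ f ∣
  weightSum-α = begin
    weightSum (k + r) r (α r k) e f
      ≡⟨ weightSum-expansion r k (γ r k) e f ∣e∣≡k ⟩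
    ∑[ T ∈ allSubsets (k + r) ]
      (if T ⊆ᵇ e then (if f ⊆ᵇ ∁ T then choose⊇ S.∣ f ∣ S.∣ ∁ T ─ f ∣ r · γ r k S.∣ T ∣ else 0ℚ) else 0ℚ)
      ≡⟨ ∑-cong (allSubsets (k + r)) term≡sign ⟩
    ∑[ T ∈ allSubsets (k + r) ] (if T ⊆ᵇ (e ─ f) then sign S.∣ T ∣ else 0ℚ)
      ≡⟨ ∑⊆≡binomialTransform (e ─ f) sign ⟩
    binomialTransform sign S.∣ e ─ f ∣ ∎
    where
    open ≡-Reasoning
    term≡sign : ∀ T →
      (if T ⊆ᵇ e then (if f ⊆ᵇ ∁ T then choose⊇ S.∣ f ∣ S.∣ ∁ T ─ f ∣ r · γ r k S.∣ T ∣ else 0ℚ) else 0ℚ)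
        ≡ (if T ⊆ᵇ (e ─ f) then sign S.∣ T ∣ else 0ℚ)
    term≡sign T rewrite ⊆ᵇ-─ T e f with T ⊆? e | f ⊆? ∁ T
    ... | yes T⊆e | yes f⊆∁T = #copies-avoiding·γ≡sign T⊆e f⊆∁T
    ... | yes _   | no _     = refl
    ... | no _    | _        = refl

  weightSum-α-diagonal : f ≡ e → weightSum (k + r) r (α r k) e f ≡ 1ℚ
  weightSum-α-diagonal refl = trans weightSum-α (cong (binomialTransform sign) (∣p─p∣≡0 e))

  weightSum-α-offDiagonal : f ≢ e → weightSum (k + r) r (α r k) e f ≡ 0ℚ
  weightSum-α-offDiagonal f≢e with S.∣ e ─ f ∣ in ∣e─f∣≡
  ... | zero  = ⊥-elim (f≢e (sym (∣p─q∣≡0⇒p≡q e f ∣e─f∣≡ (trans ∣e∣≡k (sym ∣f∣≡k)))))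
  ... | suc q = trans weightSum-α (trans (cong (binomialTransform sign) ∣e─f∣≡) (binomialTransform-sign q))

α-bound : ∀ {r k i} → k ≤ r → i ≤ k →
  Q.∣ α r k i ∣ Q.* fromℕ ((r ∸ k + i) C i) Q.≤ fromℕ (2 ^ (k ∸ i) ℕ.* (k ∸ i) !)
α-bound {r} {k} {i} k≤r i≤k = Q.≤-trans
  (∣binomialTransform∣*x≤2^q (k ∸ i) (γ r k) (fromℕ B) (fromℕ-nonNeg B) ∣γ∣*B≤1)
  (fromℕ-mono-≤ (ℕ.m≤m*n (2 ^ (k ∸ i)) ((k ∸ i) !) {{(k ∸ i) ℕ.!≢0}}))
  where
  m = r ∸ k
  B = (m + i) C i
  ∣γ∣*B≤1 : ∀ p → p ≤ k ∸ i → Q.∣ γ r k p ∣ Q.* fromℕ B Q.≤ 1ℚ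
  ∣γ∣*B≤1 p p≤k∸i = subst (λ y → y Q.* fromℕ B Q.≤ 1ℚ) (sym (∣γ∣≡recip r k p)) (recip*fromℕ≤1 B≤M)
    where
    m+i+p≤r : m + i + p ≤ r
    m+i+p≤r = begin
      m + i + p          ≡⟨ ℕ.+-assoc m i p ⟩
      m + (i + p)        ≤⟨ ℕ.+-monoʳ-≤ m (ℕ.+-monoʳ-≤ i p≤k∸i) ⟩
      m + (i + (k ∸ i))  ≡⟨ cong (λ j → m + j) (ℕ.m+[n∸m]≡n i≤k) ⟩
      m + k              ≡⟨ ℕ.m∸n+n≡m k≤r ⟩
      r                  ∎
      where open ℕ.≤-Reasoning
    B≤M : B ≤ (r ∸ p) C m
    B≤M = begin
      (m + i) C i            ≡⟨ nCk≡nC[n∸k] (ℕ.m≤n+m i m) ⟩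
      (m + i) C (m + i ∸ i)  ≡⟨ cong ((m + i) C_) (ℕ.m+n∸n≡m m i) ⟩
      (m + i) C m            ≤⟨ C-monoˡ-≤ m (ℕ.m+n≤o⇒m≤o∸n (m + i) m+i+p≤r) ⟩
      (r ∸ p) C m            ∎
      where open ℕ.≤-Reasoning

proposition3p3 :
    (r k : ℕ) → 2 ≤ k → k < r →
    Σ (ℕ → ℚ) (λ α →
      ((e : Subset (k + r)) → S.∣ e ∣ ≡ k →
        (f : Subset (k + r)) → S.∣ f ∣ ≡ k →
          (f ≡ e → weightSum (k + r) r α e f ≡ 1ℚ)
          × (f ≢ e → weightSum (k + r) r α e f ≡ 0ℚ))
      × ((i : ℕ) → i ≤ k →
          Q.∣ α i ∣ Q.* (+ ((r ∸ k + i) C i) Q./ 1)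
            Q.≤ (+ (2 ^ (k ∸ i) ℕ.* ((k ∸ i) !)) Q./ 1)))
proposition3p3 r k _ k<r =
  α r k ,
  (λ e ∣e∣≡k f ∣f∣≡k → weightSum-α-diagonal k≤r ∣e∣≡k ∣f∣≡k , weightSum-α-offDiagonal k≤r ∣e∣≡k ∣f∣≡k) ,
  (λ i i≤k → α-bound k≤r i≤k)
  where
  k≤r = ℕ.<⇒≤ k<r
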